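{- Let $a$ be a real number and $n$ a positive integer. Then $$\frac a2\sum_{k=1}^n\binom{2n}{2k}E_{2n-2k,a}\big((x+1)^{2k}+(x-1)^{2k}\big)+(1-a)\sum_{k=1}^n\binom{2n}{2k}E_{2n-2k,a}x^{2k}=x^{2n}-E_{2n,a}.$$
   Context: For a real number $a$, the sequence $\{E_{n,a}\}$ is defined by $E_{0,a}=1$ and $E_{n,a}=-a\sum_{k=1}^{\lfloor n/2\rfloor}\binom{n}{2k}E_{n-2k,a}$ for $n\ge 1$. -}

module Defs where

open import Level using (Level)
open import Algebra.Bundles using (CommutativeRing)
open import Data.Nat as ℕ using (ℕ; zero; suc; _∸_; ⌊_/2⌋)
open import Data.Nat.Combinatorics using (_C_)

-- Definitions over an arbitrary commutative ring R (the paper works in ℝ).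
module WithRing {c ℓ : Level} (R : CommutativeRing c ℓ) where
  open CommutativeRing R

  fromℕ : ℕ → Carrier
  fromℕ zero    = 0#
  fromℕ (suc n) = 1# + fromℕ n

  _^_ : Carrier → ℕ → Carrier
  x ^ zero  = 1#
  x ^ suc n = x * (x ^ n)

  Σ[1…_] : ℕ → (ℕ → Carrier) → Carrier
  Σ[1… zero ] f  = 0#
  Σ[1… suc m ] f = Σ[1… m ] f + f (suc m)

  -- Fuel-driven version of the recursion
  --   E_{0,a} = 1,
  --   E_{n,a} = -a Σ_{k=1}^{⌊n/2⌋} C(n,2k) E_{n-2k,a}   (n ≥ 1).
  -- With fuel f ≥ n every recursive call is with fuel ≥ its index,
  -- so the junk clause (fuel zero, positive index) is never reached from E.
  Efuel : Carrier → ℕ → ℕ → Carrier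
  Efuel a _       zero    = 1#
  Efuel a zero    (suc m) = 1#
  Efuel a (suc f) (suc m) =
    - a * Σ[1… ⌊ suc m /2⌋ ] (λ k → fromℕ (suc m C (2 ℕ.* k)) * Efuel a f (suc m ∸ 2 ℕ.* k))

  E : ℕ → Carrier → Carrier
  E n a = Efuel a n n

-- Halving the binomial expansions gives
-- ((x+1)^{2k} + (x-1)^{2k})/2 = Σ_{i≤k} C(2k,2i) x^{2i}, and C(2n,2k) C(2k,2i) = C(2n,2i) C(2n-2i,2k-2i),
-- so after exchanging the order of summation the left-hand side, with its k = 0 terms restored, is
-- Σ_{i≤n} C(2n,2i) x^{2i} (a T_{n-i} + (1-a) E_{2(n-i)}) where T_N = Σ_{t≤N} C(2N,2t) E_{2N-2t}.
-- The recurrence reads E_{2N} = -a (T_N - E_{2N}), so the bracket is 0 for N ≥ 1 and 1 for N = 0: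
-- only x^{2n} survives, while the restored k = 0 terms contribute exactly E_{2n}.

module Submission where

open import Defs
open import Level using (Level)
open import Algebra.Bundles using (CommutativeRing)
open import Data.Nat as ℕ using (ℕ; _≤_; _∸_)
open import Data.Nat.Combinatorics using (_C_)

open import Data.Nat using (zero; suc; _<_; s≤s; ⌊_/2⌋)
open import Data.Nat.Combinatorics using (nCn≡1)
import Data.Nat.Properties as ℕₚ
open import Data.Fin using (toℕ)
open import Function using (_∘_)
open import Relation.Binary.PropositionalEquality as ≡ using (_≡_)

module NatArithmetic where
  open import Data.Nat
  open import Data.Nat.Properties
  open import Data.Nat.Combinatorics
  open import Data.Nat.DivMod using (m/n*n≡m)
  open import Data.Nat.Tactic.RingSolver using (solve-∀)
  open ≡ using (cong; cong₂; sym; trans)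
  open ≡.≡-Reasoning

  nCk*k!*[n∸k]!≡n! : ∀ {n k} → k ≤ n → (n C k) * (k ! * (n ∸ k) !) ≡ n !
  nCk*k!*[n∸k]!≡n! {n} {k} k≤n =
    trans (cong (_* (k ! * (n ∸ k) !)) (nCk≡n!/k![n-k]! k≤n))
          (m/n*n≡m {{k !* (n ∸ k) !≢0}} (k![n∸k]!∣n! k≤n))

  -- Both sides count the pairs (I ⊆ K) of subsets of an n-set with ∣I∣ = i, ∣K∣ = k;
  -- they are compared after multiplication by i! (k ∸ i)! (n ∸ k)!.
  nCk*kCi≡nCi*[n∸i]C[k∸i] : ∀ {n k i} → i ≤ k → k ≤ n →
                             (n C k) * (k C i) ≡ (n C i) * ((n ∸ i) C (k ∸ i))
  nCk*kCi≡nCi*[n∸i]C[k∸i] {n} {k} {i} i≤k k≤n =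
    *-cancelʳ-≡ _ _ (i ! * ((k ∸ i) ! * (n ∸ k) !)) {{i!*[k∸i]!*[n∸k]!≢0}} (trans lhs≡n! (sym rhs≡n!))
    where
    i!*[k∸i]!*[n∸k]!≢0 : NonZero (i ! * ((k ∸ i) ! * (n ∸ k) !))
    i!*[k∸i]!*[n∸k]!≢0 = m*n≢0 (i !) ((k ∸ i) ! * (n ∸ k) !) {{i !≢0}} {{(k ∸ i) !* (n ∸ k) !≢0}}

    [n∸i]∸[k∸i]≡n∸k : (n ∸ i) ∸ (k ∸ i) ≡ n ∸ k
    [n∸i]∸[k∸i]≡n∸k = trans (∸-+-assoc n i (k ∸ i)) (cong (n ∸_) (m+[n∸m]≡n i≤k))

    lhs≡n! : (n C k) * (k C i) * (i ! * ((k ∸ i) ! * (n ∸ k) !)) ≡ n !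
    lhs≡n! = begin
      (n C k) * (k C i) * (i ! * ((k ∸ i) ! * (n ∸ k) !))
        ≡⟨ rearrange (n C k) (k C i) (i !) ((k ∸ i) !) ((n ∸ k) !) ⟩
      (n C k) * (((k C i) * (i ! * (k ∸ i) !)) * (n ∸ k) !)
        ≡⟨ cong (λ m → (n C k) * (m * (n ∸ k) !)) (nCk*k!*[n∸k]!≡n! i≤k) ⟩
      (n C k) * (k ! * (n ∸ k) !)
        ≡⟨ nCk*k!*[n∸k]!≡n! k≤n ⟩
      n ! ∎
      where
      rearrange : ∀ p q r s t → (p * q) * (r * (s * t)) ≡ p * ((q * (r * s)) * t)
      rearrange = solve-∀

    rhs≡n! : (n C i) * ((n ∸ i) C (k ∸ i)) * (i ! * ((k ∸ i) ! * (n ∸ k) !)) ≡ n !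
    rhs≡n! = begin
      (n C i) * ((n ∸ i) C (k ∸ i)) * (i ! * ((k ∸ i) ! * (n ∸ k) !))
        ≡⟨ rearrange (n C i) ((n ∸ i) C (k ∸ i)) (i !) ((k ∸ i) !) ((n ∸ k) !) ⟩
      (n C i) * (i ! * (((n ∸ i) C (k ∸ i)) * ((k ∸ i) ! * (n ∸ k) !)))
        ≡⟨ cong (λ m → (n C i) * (i ! * (((n ∸ i) C (k ∸ i)) * ((k ∸ i) ! * m !)))) (sym [n∸i]∸[k∸i]≡n∸k) ⟩
      (n C i) * (i ! * (((n ∸ i) C (k ∸ i)) * ((k ∸ i) ! * ((n ∸ i) ∸ (k ∸ i)) !)))
        ≡⟨ cong (λ m → (n C i) * (i ! * m)) (nCk*k!*[n∸k]!≡n! (∸-monoˡ-≤ i k≤n)) ⟩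
      (n C i) * (i ! * (n ∸ i) !)
        ≡⟨ nCk*k!*[n∸k]!≡n! (≤-trans i≤k k≤n) ⟩
      n ! ∎
      where
      rearrange : ∀ p q r s t → (p * q) * (r * (s * t)) ≡ p * (r * (q * (s * t)))
      rearrange = solve-∀

  ⌊2*n/2⌋≡n : ∀ n → ⌊ 2 * n /2⌋ ≡ n
  ⌊2*n/2⌋≡n n = sym (trans (n≡⌊n+n/2⌋ n) (cong (λ m → ⌊ n + m /2⌋) (sym (+-identityʳ n))))

  [2n]C[2[i+t]]*[2[i+t]]C[2i]≡[2n]C[2i]*[2[n∸i]]C[2t] : ∀ {n} i t → i + t ≤ n →
    (2 * n C 2 * (i + t)) * (2 * (i + t) C 2 * i) ≡ (2 * n C 2 * i) * (2 * (n ∸ i) C 2 * t)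
  [2n]C[2[i+t]]*[2[i+t]]C[2i]≡[2n]C[2i]*[2[n∸i]]C[2t] {n} i t i+t≤n = begin
    (2 * n C 2 * (i + t)) * (2 * (i + t) C 2 * i)
      ≡⟨ nCk*kCi≡nCi*[n∸i]C[k∸i] (*-monoʳ-≤ 2 (m≤m+n i t)) (*-monoʳ-≤ 2 i+t≤n) ⟩
    (2 * n C 2 * i) * ((2 * n ∸ 2 * i) C (2 * (i + t) ∸ 2 * i))
      ≡⟨ cong₂ (λ p q → (2 * n C 2 * i) * (p C q)) (sym (*-distribˡ-∸ 2 n i)) 2*[i+t]∸2*i≡2*t ⟩
    (2 * n C 2 * i) * (2 * (n ∸ i) C 2 * t) ∎
    where
    2*[i+t]∸2*i≡2*t : 2 * (i + t) ∸ 2 * i ≡ 2 * t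
    2*[i+t]∸2*i≡2*t = trans (sym (*-distribˡ-∸ 2 (i + t) i)) (cong (2 *_) (m+n∸m≡n i t))

  2*k∸[1+2*i]≡1+2*[k∸[1+i]] : ∀ {k i} → i < k → 2 * k ∸ suc (2 * i) ≡ suc (2 * (k ∸ suc i))
  2*k∸[1+2*i]≡1+2*[k∸[1+i]] {k} {i} i<k = begin
    2 * k ∸ suc (2 * i)         ≡⟨ sym (pred[m∸n]≡m∸[1+n] (2 * k) (2 * i)) ⟩
    pred (2 * k ∸ 2 * i)        ≡⟨ cong pred (sym (*-distribˡ-∸ 2 k i)) ⟩
    pred (2 * (k ∸ i))          ≡⟨ cong (pred ∘ (2 *_)) (+-∸-assoc 1 i<k) ⟩
    pred (2 * suc (k ∸ suc i))  ≡⟨ +-suc (k ∸ suc i) (k ∸ suc i + 0) ⟩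
    suc (2 * (k ∸ suc i))       ∎

  1+m∸2*[1+k]≤m : ∀ m k → suc m ∸ 2 * suc k ≤ m
  1+m∸2*[1+k]≤m m k = m∸n≤m m (k + 1 * suc k)

open NatArithmetic

module _ {c ℓ : Level} (R : CommutativeRing c ℓ) where
  open CommutativeRing R
  open WithRing R
  open import Algebra.Properties.Ring ring using (-‿distribˡ-*; -‿distribʳ-*)
  open import Algebra.Properties.AbelianGroup +-abelianGroup using (⁻¹-involutive; xyx⁻¹≈y)
  open import Algebra.Properties.Semiring.Mult semiring using (_×_; ×-congʳ; ×-assoc-*; ×1-homo-*)
  open import Algebra.Properties.Semiring.Exp semiring using () renaming (_^_ to _^ᴿ_)
  open import Algebra.Properties.Monoid.Sum +-monoid using (sum)
  import Algebra.Properties.CommutativeSemiring.Binomial commutativeSemiring as Binomial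
  open import Algebra.Solver.Ring.NaturalCoefficients.Default commutativeSemiring
    using (solve; _:+_; _:*_; _:=_)
  open import Relation.Binary.Reasoning.Setoid setoid

  fromℕ≈×1 : ∀ n → fromℕ n ≈ n × 1#
  fromℕ≈×1 zero    = refl
  fromℕ≈×1 (suc n) = +-congˡ (fromℕ≈×1 n)

  fromℕ-1 : fromℕ 1 ≈ 1#
  fromℕ-1 = +-identityʳ 1#

  fromℕ-homo-* : ∀ m n → fromℕ (m ℕ.* n) ≈ fromℕ m * fromℕ n
  fromℕ-homo-* m n = begin
    fromℕ (m ℕ.* n)      ≈⟨ fromℕ≈×1 (m ℕ.* n) ⟩
    (m ℕ.* n) × 1#       ≈⟨ ×1-homo-* m n ⟩
    (m × 1#) * (n × 1#)  ≈⟨ *-cong (fromℕ≈×1 m) (fromℕ≈×1 n) ⟨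
    fromℕ m * fromℕ n    ∎

  ×≈fromℕ* : ∀ n y → n × y ≈ fromℕ n * y
  ×≈fromℕ* n y = begin
    n × y         ≈⟨ ×-congʳ n (*-identityˡ y) ⟨
    n × (1# * y)  ≈⟨ ×-assoc-* n 1# y ⟨
    (n × 1#) * y  ≈⟨ *-congʳ (fromℕ≈×1 n) ⟨
    fromℕ n * y   ∎

  ^≈^ᴿ : ∀ y n → y ^ n ≈ y ^ᴿ n
  ^≈^ᴿ y zero    = refl
  ^≈^ᴿ y (suc n) = *-congˡ (^≈^ᴿ y n)

  1^n≈1 : ∀ n → 1# ^ n ≈ 1#
  1^n≈1 zero    = refl
  1^n≈1 (suc n) = trans (*-identityˡ _) (1^n≈1 n)

  -x*-y≈x*y : ∀ x y → - x * - y ≈ x * y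
  -x*-y≈x*y x y = begin
    - x * - y    ≈⟨ -‿distribˡ-* x (- y) ⟨
    - (x * - y)  ≈⟨ -‿cong (-‿distribʳ-* x y) ⟨
    - - (x * y)  ≈⟨ ⁻¹-involutive (x * y) ⟩
    x * y        ∎

  [-y]^[2*d]≈y^[2*d] : ∀ y d → (- y) ^ (2 ℕ.* d) ≈ y ^ (2 ℕ.* d)
  [-y]^[2*d]≈y^[2*d] y zero    = refl
  [-y]^[2*d]≈y^[2*d] y (suc d) = begin
    (- y) ^ (2 ℕ.* suc d)              ≡⟨ ≡.cong ((- y) ^_) (ℕₚ.*-suc 2 d) ⟩
    - y * (- y * (- y) ^ (2 ℕ.* d))    ≈⟨ *-congˡ (*-congˡ ([-y]^[2*d]≈y^[2*d] y d)) ⟩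
    - y * (- y * y ^ (2 ℕ.* d))        ≈⟨ *-congˡ (-‿distribˡ-* y _) ⟨
    - y * - (y * y ^ (2 ℕ.* d))        ≈⟨ -x*-y≈x*y y _ ⟩
    y * (y * y ^ (2 ℕ.* d))            ≡⟨ ≡.cong (y ^_) (ℕₚ.*-suc 2 d) ⟨
    y ^ (2 ℕ.* suc d)                  ∎

  [-y]^[1+2*d]≈-y^[1+2*d] : ∀ y d → (- y) ^ suc (2 ℕ.* d) ≈ - (y ^ suc (2 ℕ.* d))
  [-y]^[1+2*d]≈-y^[1+2*d] y d =
    trans (*-congˡ ([-y]^[2*d]≈y^[2*d] y d)) (sym (-‿distribˡ-* y _))

  1-a+a≈1 : ∀ a → (1# - a) + a ≈ 1#
  1-a+a≈1 a = trans (+-assoc 1# (- a) a) (trans (+-congˡ (-‿inverseˡ a)) (+-identityʳ 1#))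

  Σ[<_] : ℕ → (ℕ → Carrier) → Carrier
  Σ[< zero  ] f = 0#
  Σ[< suc m ] f = Σ[< m ] f + f m

  Σ[<]-cong : ∀ m {f g : ℕ → Carrier} → (∀ i → i < m → f i ≈ g i) → Σ[< m ] f ≈ Σ[< m ] g
  Σ[<]-cong zero    f≈g = refl
  Σ[<]-cong (suc m) f≈g = +-cong (Σ[<]-cong m (λ i i<m → f≈g i (ℕₚ.m<n⇒m<1+n i<m))) (f≈g m (ℕₚ.n<1+n m))

  Σ[<]-distrib-+ : ∀ m (f g : ℕ → Carrier) → Σ[< m ] (λ i → f i + g i) ≈ Σ[< m ] f + Σ[< m ] g
  Σ[<]-distrib-+ zero    f g = sym (+-identityʳ 0#)
  Σ[<]-distrib-+ (suc m) f g = trans (+-congʳ (Σ[<]-distrib-+ m f g)) (interchange _ _ _ _)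
    where
    interchange : ∀ p q r s → (p + q) + (r + s) ≈ (p + r) + (q + s)
    interchange = solve 4 (λ p q r s → (p :+ q) :+ (r :+ s) := (p :+ r) :+ (q :+ s)) refl

  *-distribˡ-Σ[<] : ∀ m y (f : ℕ → Carrier) → y * Σ[< m ] f ≈ Σ[< m ] (λ i → y * f i)
  *-distribˡ-Σ[<] zero    y f = zeroʳ y
  *-distribˡ-Σ[<] (suc m) y f = trans (distribˡ y _ _) (+-congʳ (*-distribˡ-Σ[<] m y f))

  Σ[<]-zero : ∀ m {f : ℕ → Carrier} → (∀ i → i < m → f i ≈ 0#) → Σ[< m ] f ≈ 0#
  Σ[<]-zero m f≈0 = trans (Σ[<]-cong m f≈0) (Σ[<]-const-0 m)
    where
    Σ[<]-const-0 : ∀ m → Σ[< m ] (λ _ → 0#) ≈ 0#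
    Σ[<]-const-0 zero    = refl
    Σ[<]-const-0 (suc m) = trans (+-identityʳ _) (Σ[<]-const-0 m)

  Σ[<suc]-head : ∀ m (f : ℕ → Carrier) → Σ[< suc m ] f ≈ f 0 + Σ[< m ] (f ∘ suc)
  Σ[<suc]-head zero    f = trans (+-identityˡ (f 0)) (sym (+-identityʳ (f 0)))
  Σ[<suc]-head (suc m) f = trans (+-congʳ (Σ[<suc]-head m f)) (+-assoc _ _ _)

  Σ[<suc]≈head+Σ[1…] : ∀ m (f : ℕ → Carrier) → Σ[< suc m ] f ≈ f 0 + Σ[1… m ] f
  Σ[<suc]≈head+Σ[1…] zero    f = trans (+-identityˡ (f 0)) (sym (+-identityʳ (f 0)))
  Σ[<suc]≈head+Σ[1…] (suc m) f = trans (+-congʳ (Σ[<suc]≈head+Σ[1…] m f)) (+-assoc _ _ _)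

  sum≈Σ[<] : ∀ m (f : ℕ → Carrier) → sum {m} (f ∘ toℕ) ≈ Σ[< m ] f
  sum≈Σ[<] zero    f = refl
  sum≈Σ[<] (suc m) f = trans (+-congˡ (sum≈Σ[<] m (f ∘ suc))) (sym (Σ[<suc]-head m f))

  Σ[<]-triangle-swap : ∀ n (F : ℕ → ℕ → Carrier) →
    Σ[< suc n ] (λ k → Σ[< suc k ] (F k)) ≈ Σ[< suc n ] (λ i → Σ[< suc (n ∸ i) ] (λ t → F (i ℕ.+ t) i))
  Σ[<]-triangle-swap zero    F = refl
  Σ[<]-triangle-swap (suc n) F = begin
    Σ[< suc n ] (λ k → Σ[< suc k ] (F k)) + (Σ[< suc n ] (F (suc n)) + F (suc n) (suc n))
      ≈⟨ +-congʳ (Σ[<]-triangle-swap n F) ⟩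
    Σ[< suc n ] (column n) + (Σ[< suc n ] (F (suc n)) + F (suc n) (suc n))
      ≈⟨ +-assoc _ _ _ ⟨
    (Σ[< suc n ] (column n) + Σ[< suc n ] (F (suc n))) + F (suc n) (suc n)
      ≈⟨ +-cong (Σ[<]-distrib-+ (suc n) (column n) (F (suc n))) last ⟨
    Σ[< suc n ] (λ i → column n i + F (suc n) i) + column (suc n) (suc n)
      ≈⟨ +-congʳ (Σ[<]-cong (suc n) extend) ⟩
    Σ[< suc n ] (column (suc n)) + column (suc n) (suc n)
      ∎
    where
    diagonal : ℕ → ℕ → Carrier
    diagonal i t = F (i ℕ.+ t) i

    column : ℕ → ℕ → Carrier
    column m i = Σ[< suc (m ∸ i) ] (diagonal i)

    last : column (suc n) (suc n) ≈ F (suc n) (suc n)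
    last = begin
      Σ[< suc (n ∸ n) ] (diagonal (suc n))  ≡⟨ ≡.cong (λ m → Σ[< suc m ] (diagonal (suc n))) (ℕₚ.n∸n≡0 n) ⟩
      0# + F (suc n ℕ.+ 0) (suc n)          ≈⟨ +-identityˡ _ ⟩
      F (suc n ℕ.+ 0) (suc n)               ≡⟨ ≡.cong (λ m → F m (suc n)) (ℕₚ.+-identityʳ (suc n)) ⟩
      F (suc n) (suc n)                     ∎

    extend : ∀ i → i < suc n → column n i + F (suc n) i ≈ column (suc n) i
    extend i (s≤s i≤n) = begin
      column n i + F (suc n) i                  ≡⟨ ≡.cong (λ m → column n i + F m i) suc-n≡i+suc[n∸i] ⟩
      Σ[< suc (suc (n ∸ i)) ] (diagonal i)      ≡⟨ ≡.cong (λ m → Σ[< suc m ] (diagonal i)) (ℕₚ.+-∸-assoc 1 i≤n) ⟨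
      column (suc n) i                          ∎
      where
      suc-n≡i+suc[n∸i] : suc n ≡ i ℕ.+ suc (n ∸ i)
      suc-n≡i+suc[n∸i] = ≡.trans (≡.cong suc (≡.sym (ℕₚ.m+[n∸m]≡n i≤n))) (≡.sym (ℕₚ.+-suc i (n ∸ i)))

  Σ[<]-parity : ∀ m (g : ℕ → Carrier) →
    Σ[< 2 ℕ.* m ] g ≈ Σ[< m ] (g ∘ (2 ℕ.*_)) + Σ[< m ] (g ∘ suc ∘ (2 ℕ.*_))
  Σ[<]-parity zero    g = sym (+-identityʳ 0#)
  Σ[<]-parity (suc m) g = begin
    Σ[< 2 ℕ.* suc m ] g                                       ≡⟨ ≡.cong (λ k → Σ[< k ] g) (ℕₚ.*-suc 2 m) ⟩
    Σ[< 2 ℕ.* m ] g + g (2 ℕ.* m) + g (suc (2 ℕ.* m))        ≈⟨ +-congʳ (+-congʳ (Σ[<]-parity m g)) ⟩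
    Σ[< m ] (g ∘ (2 ℕ.*_)) + Σ[< m ] (g ∘ suc ∘ (2 ℕ.*_)) + g (2 ℕ.* m) + g (suc (2 ℕ.* m))
                                                              ≈⟨ regroup _ _ _ _ ⟩
    Σ[< suc m ] (g ∘ (2 ℕ.*_)) + Σ[< suc m ] (g ∘ suc ∘ (2 ℕ.*_)) ∎
    where
    regroup : ∀ p q r s → p + q + r + s ≈ (p + r) + (q + s)
    regroup = solve 4 (λ p q r s → ((p :+ q) :+ r) :+ s := (p :+ r) :+ (q :+ s)) refl

  binomial-theorem : ∀ N x y → (x + y) ^ N ≈ Σ[< suc N ] (λ j → fromℕ (N C j) * (x ^ j * y ^ (N ∸ j)))
  binomial-theorem N x y = begin
    (x + y) ^ N   ≈⟨ ^≈^ᴿ (x + y) N ⟩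
    (x + y) ^ᴿ N  ≈⟨ Binomial.theorem N x y ⟩
    _             ≈⟨ sum≈Σ[<] (suc N) (λ j → (N C j) × (x ^ᴿ j * y ^ᴿ (N ∸ j))) ⟩
    Σ[< suc N ] (λ j → (N C j) × (x ^ᴿ j * y ^ᴿ (N ∸ j)))
      ≈⟨ Σ[<]-cong (suc N) (λ j _ → trans (×≈fromℕ* (N C j) _)
                                      (*-congˡ (sym (*-cong (^≈^ᴿ x j) (^≈^ᴿ y (N ∸ j)))))) ⟩
    Σ[< suc N ] (λ j → fromℕ (N C j) * (x ^ j * y ^ (N ∸ j))) ∎

  evenBinomialSum : Carrier → Carrier → ℕ → Carrier
  evenBinomialSum x y k = Σ[< suc k ] (λ i → fromℕ ((2 ℕ.* k) C (2 ℕ.* i)) * (x ^ (2 ℕ.* i) * y ^ (2 ℕ.* (k ∸ i))))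

  -- In the sum of the two binomial expansions the odd powers of y cancel and the even ones double.
  binomial-even-part : ∀ x y k → (x + y) ^ (2 ℕ.* k) + (x - y) ^ (2 ℕ.* k) ≈ evenBinomialSum x y k + evenBinomialSum x y k
  binomial-even-part x y k = begin
    (x + y) ^ N + (x - y) ^ N
      ≈⟨ +-cong (binomial-theorem N x y) (binomial-theorem N x (- y)) ⟩
    Σ[< suc N ] (λ j → fromℕ (N C j) * (x ^ j * y ^ (N ∸ j))) + Σ[< suc N ] (λ j → fromℕ (N C j) * (x ^ j * (- y) ^ (N ∸ j)))
      ≈⟨ Σ[<]-distrib-+ (suc N) _ _ ⟨
    Σ[< suc N ] (λ j → fromℕ (N C j) * (x ^ j * y ^ (N ∸ j)) + fromℕ (N C j) * (x ^ j * (- y) ^ (N ∸ j)))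
      ≈⟨ Σ[<]-cong (suc N) (λ j _ → factor _ _ _ _) ⟩
    Σ[< N ] g + g N
      ≈⟨ +-congʳ (Σ[<]-parity k g) ⟩
    Σ[< k ] (g ∘ (2 ℕ.*_)) + Σ[< k ] (g ∘ suc ∘ (2 ℕ.*_)) + g N
      ≈⟨ +-congʳ (+-congˡ (Σ[<]-zero k odd-term≈0)) ⟩
    Σ[< k ] (g ∘ (2 ℕ.*_)) + 0# + g N
      ≈⟨ +-congʳ (+-identityʳ _) ⟩
    Σ[< suc k ] (g ∘ (2 ℕ.*_))
      ≈⟨ Σ[<]-cong (suc k) (λ i _ → even-term i) ⟩
    Σ[< suc k ] (λ i → s i + s i)
      ≈⟨ Σ[<]-distrib-+ (suc k) s s ⟩
    evenBinomialSum x y k + evenBinomialSum x y k ∎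
    where
    N : ℕ
    N = 2 ℕ.* k

    g s : ℕ → Carrier
    g j = fromℕ (N C j) * (x ^ j * (y ^ (N ∸ j) + (- y) ^ (N ∸ j)))
    s i = fromℕ (N C (2 ℕ.* i)) * (x ^ (2 ℕ.* i) * y ^ (2 ℕ.* (k ∸ i)))

    factor : ∀ p q r t → p * (q * r) + p * (q * t) ≈ p * (q * (r + t))
    factor = solve 4 (λ p q r t → p :* (q :* r) :+ p :* (q :* t) := p :* (q :* (r :+ t))) refl

    odd-term≈0 : ∀ i → i < k → g (suc (2 ℕ.* i)) ≈ 0#
    odd-term≈0 i i<k = begin
      fromℕ (N C suc (2 ℕ.* i)) * (x ^ suc (2 ℕ.* i) * (y ^ m + (- y) ^ m))
        ≡⟨ ≡.cong (λ m → fromℕ (N C suc (2 ℕ.* i)) * (x ^ suc (2 ℕ.* i) * (y ^ m + (- y) ^ m)))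
                  (2*k∸[1+2*i]≡1+2*[k∸[1+i]] i<k) ⟩
      fromℕ (N C suc (2 ℕ.* i)) * (x ^ suc (2 ℕ.* i) * (y ^ suc d + (- y) ^ suc d))
        ≈⟨ *-congˡ (*-congˡ (trans (+-congˡ ([-y]^[1+2*d]≈-y^[1+2*d] y (k ∸ suc i))) (-‿inverseʳ _))) ⟩
      fromℕ (N C suc (2 ℕ.* i)) * (x ^ suc (2 ℕ.* i) * 0#)
        ≈⟨ trans (*-congˡ (zeroʳ _)) (zeroʳ _) ⟩
      0# ∎
      where
      m d : ℕ
      m = N ∸ suc (2 ℕ.* i)
      d = 2 ℕ.* (k ∸ suc i)

    even-term : ∀ i → g (2 ℕ.* i) ≈ s i + s i
    even-term i = begin
      fromℕ (N C (2 ℕ.* i)) * (x ^ (2 ℕ.* i) * (y ^ (N ∸ 2 ℕ.* i) + (- y) ^ (N ∸ 2 ℕ.* i)))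
        ≡⟨ ≡.cong (λ m → fromℕ (N C (2 ℕ.* i)) * (x ^ (2 ℕ.* i) * (y ^ m + (- y) ^ m)))
                  (≡.sym (ℕₚ.*-distribˡ-∸ 2 k i)) ⟩
      fromℕ (N C (2 ℕ.* i)) * (x ^ (2 ℕ.* i) * (y ^ (2 ℕ.* (k ∸ i)) + (- y) ^ (2 ℕ.* (k ∸ i))))
        ≈⟨ *-congˡ (*-congˡ (+-congˡ ([-y]^[2*d]≈y^[2*d] y (k ∸ i)))) ⟩
      fromℕ (N C (2 ℕ.* i)) * (x ^ (2 ℕ.* i) * (y ^ (2 ℕ.* (k ∸ i)) + y ^ (2 ℕ.* (k ∸ i))))
        ≈⟨ factor _ _ _ _ ⟨
      s i + s i ∎

  Σ[1…]-cong : ∀ m {f g : ℕ → Carrier} → (∀ k → f (suc k) ≈ g (suc k)) → Σ[1… m ] f ≈ Σ[1… m ] g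
  Σ[1…]-cong zero    f≈g = refl
  Σ[1…]-cong (suc m) f≈g = +-cong (Σ[1…]-cong m f≈g) (f≈g m)

  Efuel-irrelevant : ∀ a {f g} m → m ≤ f → m ≤ g → Efuel a f m ≈ Efuel a g m
  Efuel-irrelevant a zero    _         _         = refl
  Efuel-irrelevant a (suc m) (s≤s m≤f) (s≤s m≤g) = *-congˡ (Σ[1…]-cong ⌊ suc m /2⌋ (λ k → *-congˡ
    (Efuel-irrelevant a (suc m ∸ 2 ℕ.* suc k)
      (ℕₚ.≤-trans (1+m∸2*[1+k]≤m m k) m≤f) (ℕₚ.≤-trans (1+m∸2*[1+k]≤m m k) m≤g))))

  E-recurrence : ∀ a m → E (suc m) a ≈ - a * Σ[1… ⌊ suc m /2⌋ ] (λ k → fromℕ (suc m C (2 ℕ.* k)) * E (suc m ∸ 2 ℕ.* k) a)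
  E-recurrence a m = *-congˡ (Σ[1…]-cong ⌊ suc m /2⌋ (λ k → *-congˡ
    (Efuel-irrelevant a (suc m ∸ 2 ℕ.* suc k) (1+m∸2*[1+k]≤m m k) ℕₚ.≤-refl)))

  E-even-recurrence : ∀ a N →
    E (2 ℕ.* suc N) a ≈ - a * Σ[1… suc N ] (λ k → fromℕ ((2 ℕ.* suc N) C (2 ℕ.* k)) * E (2 ℕ.* suc N ∸ 2 ℕ.* k) a)
  E-even-recurrence a N = trans (E-recurrence a (ℕ.pred (2 ℕ.* suc N)))
    (reflexive (≡.cong (λ m → - a * Σ[1… m ] (λ k → fromℕ ((2 ℕ.* suc N) C (2 ℕ.* k)) * E (2 ℕ.* suc N ∸ 2 ℕ.* k) a))
                       (⌊2*n/2⌋≡n (suc N))))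

  evenBinomialTransform : (ℕ → Carrier) → ℕ → Carrier
  evenBinomialTransform e N = Σ[< suc N ] (λ t → fromℕ ((2 ℕ.* N) C (2 ℕ.* t)) * e (N ∸ t))

  evenBinomialTransform-head : ∀ e N →
    evenBinomialTransform e N ≈ e N + Σ[1… N ] (λ k → fromℕ ((2 ℕ.* N) C (2 ℕ.* k)) * e (N ∸ k))
  evenBinomialTransform-head e N = trans (Σ[<suc]≈head+Σ[1…] N _) (+-congʳ (trans (*-congʳ fromℕ-1) (*-identityˡ (e N))))

  E-even : Carrier → ℕ → Carrier
  E-even a m = E (2 ℕ.* m) a

  E-even-transform-zero : ∀ a → a * evenBinomialTransform (E-even a) 0 + (1# - a) * E-even a 0 ≈ 1#
  E-even-transform-zero a = begin
    a * evenBinomialTransform (E-even a) 0 + (1# - a) * 1#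
      ≈⟨ +-cong (*-congˡ (trans (evenBinomialTransform-head (E-even a) 0) (+-identityʳ 1#))) (*-identityʳ _) ⟩
    a * 1# + (1# - a)  ≈⟨ +-comm _ _ ⟩
    (1# - a) + a * 1#  ≈⟨ +-congˡ (*-identityʳ a) ⟩
    (1# - a) + a       ≈⟨ 1-a+a≈1 a ⟩
    1#                 ∎

  -- The recurrence says E₂ₙ = - a S, where S is the transform without its head term E₂ₙ.
  E-even-transform-suc : ∀ a N → a * evenBinomialTransform (E-even a) (suc N) + (1# - a) * E-even a (suc N) ≈ 0#
  E-even-transform-suc a N = begin
    a * evenBinomialTransform (E-even a) (suc N) + (1# - a) * e
      ≈⟨ +-congʳ (*-congˡ (trans (evenBinomialTransform-head (E-even a) (suc N)) (+-congˡ tail≈S))) ⟩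
    a * (e + S) + (1# - a) * e   ≈⟨ regroup a (1# - a) e S ⟩
    ((1# - a) + a) * e + a * S   ≈⟨ +-congʳ (trans (*-congʳ (1-a+a≈1 a)) (*-identityˡ e)) ⟩
    e + a * S                    ≈⟨ +-congʳ (E-even-recurrence a N) ⟩
    - a * S + a * S              ≈⟨ distribʳ S (- a) a ⟨
    (- a + a) * S                ≈⟨ *-congʳ (-‿inverseˡ a) ⟩
    0# * S                       ≈⟨ zeroˡ S ⟩
    0#                           ∎
    where
    e S : Carrier
    e = E (2 ℕ.* suc N) a
    S = Σ[1… suc N ] (λ k → fromℕ ((2 ℕ.* suc N) C (2 ℕ.* k)) * E (2 ℕ.* suc N ∸ 2 ℕ.* k) a)

    tail≈S : Σ[1… suc N ] (λ k → fromℕ ((2 ℕ.* suc N) C (2 ℕ.* k)) * E-even a (suc N ∸ k)) ≈ S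
    tail≈S = Σ[1…]-cong (suc N) (λ k → *-congˡ (reflexive
      (≡.cong (λ m → E m a) (ℕₚ.*-distribˡ-∸ 2 (suc N) (suc k)))))

    regroup : ∀ a b e S → a * (e + S) + b * e ≈ (b + a) * e + a * S
    regroup = solve 4 (λ a b e S → a :* (e :+ S) :+ b :* e := (b :+ a) :* e :+ a :* S) refl

  evenBinomial-convolution : ∀ n (e z : ℕ → Carrier) →
    Σ[< suc n ] (λ k → fromℕ ((2 ℕ.* n) C (2 ℕ.* k)) * e (n ∸ k) * Σ[< suc k ] (λ i → fromℕ ((2 ℕ.* k) C (2 ℕ.* i)) * z i))
    ≈ Σ[< suc n ] (λ i → fromℕ ((2 ℕ.* n) C (2 ℕ.* i)) * z i * evenBinomialTransform e (n ∸ i))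
  evenBinomial-convolution n e z = begin
    Σ[< suc n ] (λ k → u k * Σ[< suc k ] (λ i → v k i))
      ≈⟨ Σ[<]-cong (suc n) (λ k _ → *-distribˡ-Σ[<] (suc k) (u k) (v k)) ⟩
    Σ[< suc n ] (λ k → Σ[< suc k ] (λ i → u k * v k i))
      ≈⟨ Σ[<]-triangle-swap n (λ k i → u k * v k i) ⟩
    Σ[< suc n ] (λ i → Σ[< suc (n ∸ i) ] (λ t → u (i ℕ.+ t) * v (i ℕ.+ t) i))
      ≈⟨ Σ[<]-cong (suc n) (λ i i≤n → Σ[<]-cong (suc (n ∸ i)) (λ t t≤n∸i →
           regroup i t (ℕₚ.≤-pred i≤n) (ℕₚ.≤-pred t≤n∸i))) ⟩
    Σ[< suc n ] (λ i → Σ[< suc (n ∸ i) ] (λ t → v n i * w (n ∸ i) t))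
      ≈⟨ Σ[<]-cong (suc n) (λ i _ → *-distribˡ-Σ[<] (suc (n ∸ i)) (v n i) (w (n ∸ i))) ⟨
    Σ[< suc n ] (λ i → v n i * evenBinomialTransform e (n ∸ i)) ∎
    where
    u : ℕ → Carrier
    u k = fromℕ ((2 ℕ.* n) C (2 ℕ.* k)) * e (n ∸ k)

    v w : ℕ → ℕ → Carrier
    v k i = fromℕ ((2 ℕ.* k) C (2 ℕ.* i)) * z i
    w m t = fromℕ ((2 ℕ.* m) C (2 ℕ.* t)) * e (m ∸ t)

    swap-middle : ∀ p q r s → (p * q) * (r * s) ≈ (p * r) * (q * s)
    swap-middle = solve 4 (λ p q r s → (p :* q) :* (r :* s) := (p :* r) :* (q :* s)) refl

    swap-outer : ∀ p q r s → (p * q) * (r * s) ≈ (p * s) * (q * r)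
    swap-outer = solve 4 (λ p q r s → (p :* q) :* (r :* s) := (p :* s) :* (q :* r)) refl

    regroup : ∀ i t → i ≤ n → t ≤ n ∸ i → u (i ℕ.+ t) * v (i ℕ.+ t) i ≈ v n i * w (n ∸ i) t
    regroup i t i≤n t≤n∸i = begin
      (A * e (n ∸ (i ℕ.+ t))) * (B * z i)  ≈⟨ swap-middle A (e (n ∸ (i ℕ.+ t))) B (z i) ⟩
      (A * B) * (e (n ∸ (i ℕ.+ t)) * z i)  ≈⟨ *-cong A*B≈A′*B′ (*-congʳ (reflexive (≡.cong e (≡.sym (ℕₚ.∸-+-assoc n i t))))) ⟩
      (A′ * B′) * (e (n ∸ i ∸ t) * z i)      ≈⟨ swap-outer A′ B′ (e (n ∸ i ∸ t)) (z i) ⟩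
      (A′ * z i) * (B′ * e (n ∸ i ∸ t))      ∎
      where
      A B A′ B′ : Carrier
      A = fromℕ ((2 ℕ.* n) C (2 ℕ.* (i ℕ.+ t)))
      B = fromℕ ((2 ℕ.* (i ℕ.+ t)) C (2 ℕ.* i))
      A′ = fromℕ ((2 ℕ.* n) C (2 ℕ.* i))
      B′ = fromℕ ((2 ℕ.* (n ∸ i)) C (2 ℕ.* t))

      A*B≈A′*B′ : A * B ≈ A′ * B′
      A*B≈A′*B′ = begin
        A * B    ≈⟨ fromℕ-homo-* ((2 ℕ.* n) C (2 ℕ.* (i ℕ.+ t))) ((2 ℕ.* (i ℕ.+ t)) C (2 ℕ.* i)) ⟨
        fromℕ (((2 ℕ.* n) C (2 ℕ.* (i ℕ.+ t))) ℕ.* ((2 ℕ.* (i ℕ.+ t)) C (2 ℕ.* i)))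
                 ≡⟨ ≡.cong fromℕ ([2n]C[2[i+t]]*[2[i+t]]C[2i]≡[2n]C[2i]*[2[n∸i]]C[2t] i t i+t≤n) ⟩
        fromℕ (((2 ℕ.* n) C (2 ℕ.* i)) ℕ.* ((2 ℕ.* (n ∸ i)) C (2 ℕ.* t)))
                 ≈⟨ fromℕ-homo-* ((2 ℕ.* n) C (2 ℕ.* i)) ((2 ℕ.* (n ∸ i)) C (2 ℕ.* t)) ⟩
        A′ * B′  ∎
        where
        i+t≤n : i ℕ.+ t ≤ n
        i+t≤n = ℕₚ.≤-trans (ℕₚ.+-monoʳ-≤ i t≤n∸i) (ℕₚ.≤-reflexive (ℕₚ.m+[n∸m]≡n i≤n))

  Σ[<]-linear : ∀ m α β (f g : ℕ → Carrier) → α * Σ[< m ] f + β * Σ[< m ] g ≈ Σ[< m ] (λ i → α * f i + β * g i)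
  Σ[<]-linear m α β f g = trans (+-cong (*-distribˡ-Σ[<] m α f) (*-distribˡ-Σ[<] m β g)) (sym (Σ[<]-distrib-+ m _ _))

  weight : Carrier → ℕ → ℕ → Carrier
  weight a n k = fromℕ ((2 ℕ.* n) C (2 ℕ.* k)) * E (2 ℕ.* n ∸ 2 ℕ.* k) a

  weight≈ : ∀ a n k → weight a n k ≈ fromℕ ((2 ℕ.* n) C (2 ℕ.* k)) * E-even a (n ∸ k)
  weight≈ a n k = *-congˡ (reflexive (≡.cong (λ m → E m a) (≡.sym (ℕₚ.*-distribˡ-∸ 2 n k))))

  E-convolution-identity : ∀ a x n →
    a * Σ[< suc n ] (λ k → weight a n k * Σ[< suc k ] (λ i → fromℕ ((2 ℕ.* k) C (2 ℕ.* i)) * x ^ (2 ℕ.* i)))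
    + (1# - a) * Σ[< suc n ] (λ k → weight a n k * x ^ (2 ℕ.* k))
    ≈ x ^ (2 ℕ.* n)
  E-convolution-identity a x n = begin
    a * Σ[< suc n ] (λ k → weight a n k * Σ[< suc k ] (λ i → fromℕ ((2 ℕ.* k) C (2 ℕ.* i)) * x ^ (2 ℕ.* i)))
    + (1# - a) * Σ[< suc n ] (λ k → weight a n k * x ^ (2 ℕ.* k))
      ≈⟨ +-cong (*-congˡ (trans (Σ[<]-cong (suc n) (λ k _ → *-congʳ (weight≈ a n k)))
                                 (evenBinomial-convolution n (E-even a) (λ i → x ^ (2 ℕ.* i)))))
                (*-congˡ (Σ[<]-cong (suc n) (λ k _ → trans (*-congʳ (weight≈ a n k)) (swap _ _ _)))) ⟩
    a * Σ[< suc n ] (λ i → γ i * evenBinomialTransform (E-even a) (n ∸ i))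
    + (1# - a) * Σ[< suc n ] (λ i → γ i * E-even a (n ∸ i))
      ≈⟨ Σ[<]-linear (suc n) a (1# - a) _ _ ⟩
    Σ[< suc n ] (λ i → a * (γ i * evenBinomialTransform (E-even a) (n ∸ i)) + (1# - a) * (γ i * E-even a (n ∸ i)))
      ≈⟨ Σ[<]-cong (suc n) (λ i _ → factor a (1# - a) (γ i) _ _) ⟩
    Σ[< n ] (λ i → γ i * ρ (n ∸ i)) + γ n * ρ (n ∸ n)
      ≈⟨ +-cong (Σ[<]-zero n (λ i i<n → trans (*-congˡ (ρ[n∸i]≈0 i i<n)) (zeroʳ (γ i)))) ρ[n∸n]≈1 ⟩
    0# + γ n
      ≈⟨ +-identityˡ (γ n) ⟩
    fromℕ ((2 ℕ.* n) C (2 ℕ.* n)) * x ^ (2 ℕ.* n)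
      ≈⟨ *-congʳ (trans (reflexive (≡.cong fromℕ (nCn≡1 (2 ℕ.* n)))) fromℕ-1) ⟩
    1# * x ^ (2 ℕ.* n)
      ≈⟨ *-identityˡ _ ⟩
    x ^ (2 ℕ.* n) ∎
    where
    γ ρ : ℕ → Carrier
    γ i = fromℕ ((2 ℕ.* n) C (2 ℕ.* i)) * x ^ (2 ℕ.* i)
    ρ m = a * evenBinomialTransform (E-even a) m + (1# - a) * E-even a m

    swap : ∀ p q r → (p * q) * r ≈ (p * r) * q
    swap = solve 3 (λ p q r → (p :* q) :* r := (p :* r) :* q) refl

    factor : ∀ α β p q r → α * (p * q) + β * (p * r) ≈ p * (α * q + β * r)
    factor = solve 5 (λ α β p q r → α :* (p :* q) :+ β :* (p :* r) := p :* (α :* q :+ β :* r)) refl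

    ρ[n∸i]≈0 : ∀ i → i < n → ρ (n ∸ i) ≈ 0#
    ρ[n∸i]≈0 i i<n = trans (reflexive (≡.cong ρ (ℕₚ.+-∸-assoc 1 i<n))) (E-even-transform-suc a (n ∸ suc i))

    ρ[n∸n]≈1 : γ n * ρ (n ∸ n) ≈ γ n
    ρ[n∸n]≈1 = trans (*-congˡ (trans (reflexive (≡.cong ρ (ℕₚ.n∸n≡0 n))) (E-even-transform-zero a))) (*-identityʳ (γ n))

  half-even-part-at-1 : ∀ {h} → h + h ≈ 1# → ∀ x k →
    h * ((x + 1#) ^ (2 ℕ.* k) + (x - 1#) ^ (2 ℕ.* k)) ≈ Σ[< suc k ] (λ i → fromℕ ((2 ℕ.* k) C (2 ℕ.* i)) * x ^ (2 ℕ.* i))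
  half-even-part-at-1 {h} h+h≈1 x k = begin
    h * ((x + 1#) ^ (2 ℕ.* k) + (x - 1#) ^ (2 ℕ.* k))  ≈⟨ *-congˡ (binomial-even-part x 1# k) ⟩
    h * (S + S)                                        ≈⟨ halve h S ⟩
    (h + h) * S                                        ≈⟨ trans (*-congʳ h+h≈1) (*-identityˡ S) ⟩
    S                                                  ≈⟨ Σ[<]-cong (suc k) (λ i _ → *-congˡ (trans (*-congˡ (1^n≈1 (2 ℕ.* (k ∸ i)))) (*-identityʳ _))) ⟩
    Σ[< suc k ] (λ i → fromℕ ((2 ℕ.* k) C (2 ℕ.* i)) * x ^ (2 ℕ.* i)) ∎
    where
    S : Carrier
    S = evenBinomialSum x 1# k

    halve : ∀ h S → h * (S + S) ≈ (h + h) * S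
    halve = solve 2 (λ h S → h :* (S :+ S) := (h :+ h) :* S) refl

  full-sum-identity : ∀ {h} → h + h ≈ 1# → ∀ a x n →
    (a * h) * Σ[< suc n ] (λ k → weight a n k * ((x + 1#) ^ (2 ℕ.* k) + (x - 1#) ^ (2 ℕ.* k)))
    + (1# - a) * Σ[< suc n ] (λ k → weight a n k * x ^ (2 ℕ.* k))
    ≈ x ^ (2 ℕ.* n)
  full-sum-identity {h} h+h≈1 a x n = trans (+-congʳ halved) (E-convolution-identity a x n)
    where
    halved : (a * h) * Σ[< suc n ] (λ k → weight a n k * ((x + 1#) ^ (2 ℕ.* k) + (x - 1#) ^ (2 ℕ.* k)))
             ≈ a * Σ[< suc n ] (λ k → weight a n k * Σ[< suc k ] (λ i → fromℕ ((2 ℕ.* k) C (2 ℕ.* i)) * x ^ (2 ℕ.* i)))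
    halved = begin
      (a * h) * Σ[< suc n ] _               ≈⟨ *-assoc a h _ ⟩
      a * (h * Σ[< suc n ] _)               ≈⟨ *-congˡ (*-distribˡ-Σ[<] (suc n) h _) ⟩
      a * Σ[< suc n ] (λ k → h * (weight a n k * _))
        ≈⟨ *-congˡ (Σ[<]-cong (suc n) (λ k _ → trans (x∙yz≈y∙xz h (weight a n k) _)
                                                      (*-congˡ (half-even-part-at-1 h+h≈1 x k)))) ⟩
      a * Σ[< suc n ] _                     ∎
      where
      x∙yz≈y∙xz : ∀ p q r → p * (q * r) ≈ q * (p * r)
      x∙yz≈y∙xz = solve 3 (λ p q r → p :* (q :* r) := q :* (p :* r)) refl

  first-terms : ∀ {h} → h + h ≈ 1# → ∀ a x n →
    (a * h) * (weight a n 0 * ((x + 1#) ^ 0 + (x - 1#) ^ 0)) + (1# - a) * (weight a n 0 * x ^ 0) ≈ E (2 ℕ.* n) a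
  first-terms {h} h+h≈1 a x n = begin
    (a * h) * (weight a n 0 * (1# + 1#)) + (1# - a) * (weight a n 0 * 1#)
      ≈⟨ regroup a h (1# - a) (weight a n 0) 1# ⟩
    (a * (h + h) + (1# - a)) * (weight a n 0 * 1#)
      ≈⟨ *-cong (+-congʳ (trans (*-congˡ h+h≈1) (*-identityʳ a))) (*-identityʳ _) ⟩
    (a + (1# - a)) * weight a n 0
      ≈⟨ *-cong (trans (+-comm a _) (1-a+a≈1 a)) (trans (*-congʳ fromℕ-1) (*-identityˡ _)) ⟩
    1# * E (2 ℕ.* n) a
      ≈⟨ *-identityˡ _ ⟩
    E (2 ℕ.* n) a ∎
    where
    regroup : ∀ a h b w o → (a * h) * (w * (o + o)) + b * (w * o) ≈ (a * (h + h) + b) * (w * o)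
    regroup = solve 5 (λ a h b w o → (a :* h) :* (w :* (o :+ o)) :+ b :* (w :* o) := (a :* (h :+ h) :+ b) :* (w :* o)) refl

  Σ[1…]-combination : ∀ n {α β X e} {p q : ℕ → Carrier} →
    α * Σ[< suc n ] p + β * Σ[< suc n ] q ≈ X → α * p 0 + β * q 0 ≈ e →
    α * Σ[1… n ] p + β * Σ[1… n ] q ≈ X - e
  Σ[1…]-combination n {α} {β} {X} {e} {p} {q} full first = begin
    L                                                     ≈⟨ xyx⁻¹≈y e L ⟨
    e + L - e                                             ≈⟨ +-congʳ (+-congʳ first) ⟨
    (α * p 0 + β * q 0) + L - e                           ≈⟨ +-congʳ (regroup α β (p 0) (q 0) _ _) ⟩
    α * (p 0 + Σ[1… n ] p) + β * (q 0 + Σ[1… n ] q) - e   ≈⟨ +-congʳ (+-cong (*-congˡ (Σ[<suc]≈head+Σ[1…] n p))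
                                                                             (*-congˡ (Σ[<suc]≈head+Σ[1…] n q))) ⟨
    α * Σ[< suc n ] p + β * Σ[< suc n ] q - e             ≈⟨ +-congʳ full ⟩
    X - e                                                 ∎
    where
    L : Carrier
    L = α * Σ[1… n ] p + β * Σ[1… n ] q

    regroup : ∀ α β p₀ q₀ P Q → (α * p₀ + β * q₀) + (α * P + β * Q) ≈ α * (p₀ + P) + β * (q₀ + Q)
    regroup = solve 6 (λ α β p₀ q₀ P Q → (α :* p₀ :+ β :* q₀) :+ (α :* P :+ β :* Q) := α :* (p₀ :+ P) :+ β :* (q₀ :+ Q)) refl

corollary2p2 : {c ℓ : Level} (R : CommutativeRing c ℓ) →
    let open CommutativeRing R
        open WithRing R
    in (h : Carrier) → h + h ≈ 1# →
       (a x : Carrier) (n : ℕ) → 1 ≤ n →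
       (a * h) * Σ[1… n ] (λ k → fromℕ ((2 ℕ.* n) C (2 ℕ.* k)) * E (2 ℕ.* n ∸ 2 ℕ.* k) a
                                   * (((x + 1#) ^ (2 ℕ.* k)) + ((x - 1#) ^ (2 ℕ.* k))))
       + (1# - a) * Σ[1… n ] (λ k → fromℕ ((2 ℕ.* n) C (2 ℕ.* k)) * E (2 ℕ.* n ∸ 2 ℕ.* k) a
                                   * (x ^ (2 ℕ.* k)))
       ≈ (x ^ (2 ℕ.* n)) - E (2 ℕ.* n) a
-- The identity also holds for n = 0.
corollary2p2 R h h+h≈1 a x n _ =
  Σ[1…]-combination R n (full-sum-identity R h+h≈1 a x n) (first-terms R h+h≈1 a x n)
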